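{- Let $D$ be a digraph containing an out-branching and an in-branching, and let $k\ge 0$ be an integer. If $D$ contains an out-branching $T$ with at least $k+1$ leaves, then every in-branching $T'$ of $D$ satisfies $|A(T)\setminus A(T')|\ge k$. Similarly, if $D$ contains an in-branching $T$ with at least $k+1$ leaves, then every out-branching $T'$ of $D$ satisfies $|A(T')\setminus A(T)|\ge k$.
   Context: An out-tree (in-tree) is an oriented tree with exactly one vertex of in-degree zero (out-degree zero), called its root. A leaf of an out-tree (in-tree) is a vertex of out-degree zero (in-degree zero). An out-branching (in-branching) of a digraph $D$ is an out-tree (in-tree) that is a spanning subgraph of $D$. -}

module Defs where

open import Data.Nat using (ℕ; zero; suc; _+_; _≤_; _≡ᵇ_)
open import Data.Fin using (Fin)
import Data.Fin as F
open import Data.Bool using (Bool; true; false; _∧_; _∨_; not; if_then_else_)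
open import Data.List using (List; []; _∷_; _++_; [_]; length)
open import Data.List.Relation.Unary.Unique.Propositional using (Unique)
open import Data.Product using (Σ; _×_; ∃)
open import Data.Unit using (⊤)
open import Relation.Nullary using (¬_)
open import Relation.Binary.PropositionalEquality using (_≡_)
open import Relation.Binary.Construct.Closure.ReflexiveTransitive using (Star)

-- A digraph (and any spanning subgraph of it) on the vertex set Fin n is
-- given by its arc set, as a Boolean adjacency relation: (u , v) is an arc
-- iff A u v ≡ true.
Digraph : ℕ → Set
Digraph n = Fin n → Fin n → Bool

count : ∀ {n} → (Fin n → Bool) → ℕ
count {zero}  f = 0
count {suc n} f = (if f F.zero then 1 else 0) + count (λ i → f (F.suc i))

_⊆ᴬ_ : ∀ {n} → Digraph n → Digraph n → Set
H ⊆ᴬ D = ∀ u v → H u v ≡ true → D u v ≡ true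

outdeg : ∀ {n} → Digraph n → Fin n → ℕ
outdeg T u = count (λ v → T u v)

indeg : ∀ {n} → Digraph n → Fin n → ℕ
indeg T v = count (λ u → T u v)

Adj : ∀ {n} → Digraph n → Fin n → Fin n → Set
Adj T u v = (T u v ∨ T v u) ≡ true

Walk : ∀ {n} → Digraph n → List (Fin n) → Set
Walk T []            = ⊤
Walk T (x ∷ [])      = ⊤
Walk T (x ∷ y ∷ xs)  = Adj T x y × Walk T (y ∷ xs)

HasCycle : ∀ {n} → Digraph n → Set
HasCycle {n} T = Σ (Fin n) λ x → Σ (List (Fin n)) λ vs →
  (2 ≤ length vs) × Unique (x ∷ vs) × Walk T (x ∷ vs ++ [ x ])

Connected : ∀ {n} → Digraph n → Set
Connected T = ∀ u v → Star (Adj T) u v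

Oriented : ∀ {n} → Digraph n → Set
Oriented T = (∀ u → T u u ≡ false) × (∀ u v → T u v ≡ true → T v u ≡ false)

OrientedTree : ∀ {n} → Digraph n → Set
OrientedTree T = Oriented T × Connected T × ¬ HasCycle T

ExactlyOne : ∀ {n} → (Fin n → Set) → Set
ExactlyOne {n} P = Σ (Fin n) λ r → P r × (∀ v → P v → v ≡ r)

OutTree : ∀ {n} → Digraph n → Set
OutTree T = OrientedTree T × ExactlyOne (λ v → indeg T v ≡ 0)

InTree : ∀ {n} → Digraph n → Set
InTree T = OrientedTree T × ExactlyOne (λ v → outdeg T v ≡ 0)

outLeaves : ∀ {n} → Digraph n → ℕ
outLeaves T = count (λ v → outdeg T v ≡ᵇ 0)

inLeaves : ∀ {n} → Digraph n → ℕ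
inLeaves T = count (λ v → indeg T v ≡ᵇ 0)

-- spanning out-/in-trees of D (the vertex set is all of Fin n)
OutBranching : ∀ {n} → Digraph n → Digraph n → Set
OutBranching D T = OutTree T × T ⊆ᴬ D

InBranching : ∀ {n} → Digraph n → Digraph n → Set
InBranching D T = InTree T × T ⊆ᴬ D

sumFin : ∀ {n} → (Fin n → ℕ) → ℕ
sumFin {zero}  f = 0
sumFin {suc n} f = f F.zero + sumFin (λ i → f (F.suc i))

arcDiff : ∀ {n} → Digraph n → Digraph n → ℕ
arcDiff T T' = sumFin (λ u → count (λ v → T u v ∧ not (T' u v)))

module Submission where

-- Write |A(T)| for the number of arcs of a digraph T on n vertices.
--
-- * In an out-tree every vertex except the root has in-degree at least one,
--   so an out-branching T has n ≤ 1 + |A(T)|.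
-- * In an in-tree every vertex has out-degree at most one: following
--   out-arcs from two distinct out-neighbours of a vertex u leads, without
--   repetition, to the unique sink, and the two walks together with u close
--   a cycle.  Hence an in-branching T' has 1 + |A(T')| ≤ n.
--
-- Together |A(T')| ≤ |A(T)|, and cancelling the common arcs gives
-- |A(T') \ A(T)| ≤ |A(T) \ A(T')|.  Every leaf of T other than the sink of
-- T' has an out-arc in T' that is not in T, so k ≤ |A(T') \ A(T)|; this is
-- the first claim.  Dually, every leaf of an in-branching T other than the
-- root of an out-branching T' has an in-arc of T' that is not in T, which is
-- the second claim directly.

open import Defs
open import Data.Nat using (ℕ; zero; suc; _+_; _≤_; _<_; z≤n; s≤s; _≡ᵇ_; _≤?_)
open import Data.Nat.Properties
  using (≤-trans; ≤-pred; +-mono-≤; +-suc; +-cancelˡ-≤; m≤n+m;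
         m<m+n; <-≤-trans; n≮0; n≢0⇒n>0; ≰⇒>; ≡ᵇ⇒≡; +-commutativeSemigroup;
         module ≤-Reasoning)
open import Algebra.Properties.CommutativeSemigroup +-commutativeSemigroup
  using (interchange)
open import Data.Fin using (Fin) renaming (zero to fz; suc to fs)
open import Data.Fin.Properties using (_≟_; suc-injective)
open import Data.Bool using (Bool; true; false; _∧_; not; if_then_else_)
open import Data.Bool.Properties using (∧-comm; ∧-zeroʳ; ∨-comm; ∨-zeroʳ; T-≡)
open import Data.List using (List; []; _∷_; _++_; [_]; reverse; reverseAcc)
open import Data.List.Properties using (++-assoc; reverse-++)
open import Data.List.Relation.Unary.Any using (here; there)
open import Data.List.Relation.Unary.Any.Properties using (reverse⁺)
open import Data.List.Relation.Unary.All as All using (All; []; _∷_)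
open import Data.List.Relation.Unary.All.Properties using (++⁻ˡ; ++⁻ʳ; ++⁺; ¬Any⇒All¬)
open import Data.List.Relation.Unary.AllPairs using ([]; _∷_)
open import Data.List.Relation.Unary.Unique.Propositional using (Unique)
open import Data.List.Relation.Binary.Permutation.Propositional using (↭-sym; ↭⇒↭ₛ)
open import Data.List.Relation.Binary.Permutation.Propositional.Properties using (↭-reverse)
import Data.List.Relation.Binary.Permutation.Setoid.Properties as PermutationProperties
open import Data.List.Membership.Propositional using (_∈_; _∉_)
open import Data.List.Membership.Propositional.Properties using (∈-∃++; ∈-++⁺ˡ; ∈-++⁺ʳ)
import Data.List.Membership.DecPropositional as DecMembership
open import Data.Product using (Σ; _×_; _,_; proj₁; proj₂)
open import Data.Sum using (_⊎_; inj₁; inj₂)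
open import Data.Unit using (tt)
open import Data.Empty using (⊥; ⊥-elim)
open import Function using (_∘_; Equivalence)
open import Relation.Nullary using (¬_; yes; no; does)
open import Relation.Nullary.Decidable using (dec-true; dec-false)
open import Relation.Binary.PropositionalEquality
  using (_≡_; _≢_; refl; sym; trans; cong; cong₂; subst; setoid; module ≡-Reasoning)

-- Counting over Fin n

-- count f is the sum of the 0/1 indicators of f; this reduces counting
-- identities to identities between sums.
indicator : Bool → ℕ
indicator b = if b then 1 else 0

count-as-sum : ∀ {n} (f : Fin n → Bool) → count f ≡ sumFin (indicator ∘ f)
count-as-sum {zero}  f = refl
count-as-sum {suc n} f = cong (indicator (f fz) +_) (count-as-sum (f ∘ fs))

sumFin-cong : ∀ {n} (f g : Fin n → ℕ) → (∀ v → f v ≡ g v) → sumFin f ≡ sumFin g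
sumFin-cong {zero}  f g f≡g = refl
sumFin-cong {suc n} f g f≡g = cong₂ _+_ (f≡g fz) (sumFin-cong (f ∘ fs) (g ∘ fs) (f≡g ∘ fs))

sumFin-+ : ∀ {n} (f g : Fin n → ℕ) → sumFin (λ v → f v + g v) ≡ sumFin f + sumFin g
sumFin-+ {zero}  f g = refl
sumFin-+ {suc n} f g = trans (cong (f fz + g fz +_) (sumFin-+ (f ∘ fs) (g ∘ fs)))
                             (interchange (f fz) (g fz) (sumFin (f ∘ fs)) (sumFin (g ∘ fs)))

sumFin-zero : ∀ {n} → sumFin {n} (λ _ → 0) ≡ 0
sumFin-zero {zero}  = refl
sumFin-zero {suc n} = sumFin-zero {n}

sumFin-swap : ∀ {m n} (G : Fin m → Fin n → ℕ) →
  sumFin (λ u → sumFin (G u)) ≡ sumFin (λ v → sumFin (λ u → G u v))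
sumFin-swap {zero}  {n} G = sym (sumFin-zero {n})
sumFin-swap {suc m}     G =
  trans (cong (sumFin (G fz) +_) (sumFin-swap (G ∘ fs)))
        (sym (sumFin-+ (G fz) (λ v → sumFin (λ u → G (fs u) v))))

count-swap : ∀ {n} (F : Fin n → Fin n → Bool) →
  sumFin (λ u → count (F u)) ≡ sumFin (λ v → count (λ u → F u v))
count-swap F = begin
  sumFin (λ u → count (F u))                          ≡⟨ sumFin-cong _ _ (λ u → count-as-sum (F u)) ⟩
  sumFin (λ u → sumFin (λ v → indicator (F u v)))     ≡⟨ sumFin-swap (λ u v → indicator (F u v)) ⟩
  sumFin (λ v → sumFin (λ u → indicator (F u v)))     ≡⟨ sumFin-cong _ _ (λ v → sym (count-as-sum (λ u → F u v))) ⟩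
  sumFin (λ v → count (λ u → F u v))                  ∎
  where open ≡-Reasoning

count-cong : ∀ {n} (f g : Fin n → Bool) → (∀ v → f v ≡ g v) → count f ≡ count g
count-cong f g f≡g =
  trans (count-as-sum f)
        (trans (sumFin-cong _ _ (cong indicator ∘ f≡g)) (sym (count-as-sum g)))

count-split : ∀ {n} (f g : Fin n → Bool) →
  count f ≡ count (λ v → f v ∧ g v) + count (λ v → f v ∧ not (g v))
count-split f g = begin
  count f                                                   ≡⟨ count-as-sum f ⟩
  sumFin (indicator ∘ f)                                    ≡⟨ sumFin-cong _ _ (λ v → indicator-split (f v) (g v)) ⟩
  sumFin (λ v → indicator (f v ∧ g v) + indicator (f v ∧ not (g v)))
                                                            ≡⟨ sumFin-+ (λ v → indicator (f v ∧ g v)) (λ v → indicator (f v ∧ not (g v))) ⟩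
  sumFin (λ v → indicator (f v ∧ g v)) + sumFin (λ v → indicator (f v ∧ not (g v)))
                                                            ≡⟨ sym (cong₂ _+_ (count-as-sum (λ v → f v ∧ g v)) (count-as-sum (λ v → f v ∧ not (g v)))) ⟩
  count (λ v → f v ∧ g v) + count (λ v → f v ∧ not (g v))   ∎
  where
  open ≡-Reasoning
  indicator-split : ∀ a b → indicator a ≡ indicator (a ∧ b) + indicator (a ∧ not b)
  indicator-split true  true  = refl
  indicator-split true  false = refl
  indicator-split false _     = refl

count-witness : ∀ {n} (f : Fin n → Bool) v → f v ≡ true → 1 ≤ count f
count-witness f fz fv rewrite fv = s≤s z≤n
count-witness f (fs v) fv with f fz
... | true  = s≤s z≤n
... | false = count-witness (f ∘ fs) v fv

count-zero : ∀ {n} (f : Fin n → Bool) → count f ≡ 0 → ∀ v → f v ≡ false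
count-zero f none v with f v in fv
... | true  = ⊥-elim (n≮0 (subst (1 ≤_) none (count-witness f v fv)))
... | false = refl

count-pos : ∀ {n} (f : Fin n → Bool) → 1 ≤ count f → Σ (Fin n) λ v → f v ≡ true
count-pos {suc n} f pos with f fz in f0
... | true  = fz , f0
... | false with count-pos (f ∘ fs) pos
...   | v , fv = fs v , fv

count-two : ∀ {n} (f : Fin n → Bool) → 2 ≤ count f →
  Σ (Fin n) λ a → Σ (Fin n) λ b → a ≢ b × f a ≡ true × f b ≡ true
count-two {suc n} f two with f fz in f0
... | true with count-pos (f ∘ fs) (≤-pred two)
...   | v , fv = fz , fs v , (λ ()) , f0 , fv
count-two {suc n} f two | false with count-two (f ∘ fs) two
...   | a , b , a≢b , fa , fb = fs a , fs b , a≢b ∘ suc-injective , fa , fb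

count-< : ∀ {n} (f g : Fin n → Bool) → (∀ v → f v ≡ true → g v ≡ true) →
  ∀ y → g y ≡ true → f y ≡ false → count f < count g
count-< f g f⊆g y gy fy = begin-strict
  count f                                                   ≡⟨ count-cong _ _ restrict ⟨
  count (λ v → g v ∧ f v)                                   <⟨ m<m+n _ (count-witness _ y outside) ⟩
  count (λ v → g v ∧ f v) + count (λ v → g v ∧ not (f v))   ≡⟨ count-split g f ⟨
  count g                                                   ∎
  where
  open ≤-Reasoning
  restrict : ∀ v → (g v ∧ f v) ≡ f v
  restrict v with f v in fv
  ... | true  rewrite f⊆g v fv = refl
  ... | false = ∧-zeroʳ (g v)
  outside : (g y ∧ not (f y)) ≡ true
  outside rewrite gy | fy = refl

sum-≤-length : ∀ {n} (g : Fin n → ℕ) → (∀ v → g v ≤ 1) → sumFin g ≤ n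
sum-≤-length {zero}  g g≤1 = z≤n
sum-≤-length {suc n} g g≤1 = +-mono-≤ (g≤1 fz) (sum-≤-length (g ∘ fs) (g≤1 ∘ fs))

sum-<-length : ∀ {n} (g : Fin n → ℕ) (r : Fin n) → (∀ v → g v ≤ 1) → g r ≡ 0 →
  sumFin g < n
sum-<-length g fz     g≤1 gr rewrite gr = s≤s (sum-≤-length (g ∘ fs) (g≤1 ∘ fs))
sum-<-length {suc n} g (fs r) g≤1 gr =
  subst (_≤ suc n) (+-suc (g fz) _) (+-mono-≤ (g≤1 fz) (sum-<-length (g ∘ fs) r (g≤1 ∘ fs) gr))

indicator-≤ : ∀ b {m} → (b ≡ true → 1 ≤ m) → indicator b ≤ m
indicator-≤ true  pos = pos refl
indicator-≤ false pos = z≤n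

count-≤-length : ∀ {n} (f : Fin n → Bool) → count f ≤ n
count-≤-length {n} f =
  subst (_≤ n) (sym (count-as-sum f)) (sum-≤-length _ (λ v → indicator-≤ (f v) (λ _ → s≤s z≤n)))

count-≤-sum : ∀ {n} (P : Fin n → Bool) (g : Fin n → ℕ) →
  (∀ v → P v ≡ true → 1 ≤ g v) → count P ≤ sumFin g
count-≤-sum {zero}  P g cover = z≤n
count-≤-sum {suc n} P g cover =
  +-mono-≤ (indicator-≤ (P fz) (cover fz)) (count-≤-sum (P ∘ fs) (g ∘ fs) (cover ∘ fs))

-- If g is positive on every element of P except possibly r, then g
-- sums to at least count P - 1.  This bounds leaves by new arcs.
count-≤-suc-sum : ∀ {n} (P : Fin n → Bool) (g : Fin n → ℕ) (r : Fin n) →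
  (∀ v → P v ≡ true → v ≢ r → 1 ≤ g v) → count P ≤ suc (sumFin g)
count-≤-suc-sum P g fz cover =
  +-mono-≤ (indicator-≤ (P fz) {1} (λ _ → s≤s z≤n))
           (≤-trans (count-≤-sum (P ∘ fs) (g ∘ fs) (λ v p → cover (fs v) p (λ ()))) (m≤n+m _ (g fz)))
count-≤-suc-sum P g (fs r) cover =
  subst (count P ≤_) (+-suc (g fz) _)
    (+-mono-≤ (indicator-≤ (P fz) (λ p → cover fz p (λ ())))
              (count-≤-suc-sum (P ∘ fs) (g ∘ fs) r (λ v p v≢r → cover (fs v) p (v≢r ∘ suc-injective))))

count-all : ∀ {n} → count {n} (λ _ → true) ≡ n
count-all {zero}  = refl
count-all {suc n} = cong suc (count-all {n})

-- Arc counts of digraphs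

arcs : ∀ {n} → Digraph n → ℕ
arcs T = sumFin (outdeg T)

_∩_ : ∀ {n} → Digraph n → Digraph n → Digraph n
(G ∩ H) u v = G u v ∧ H u v

arcs-split : ∀ {n} (G H : Digraph n) → arcs G ≡ arcs (G ∩ H) + arcDiff G H
arcs-split G H = trans (sumFin-cong _ _ (λ u → count-split (G u) (H u)))
                       (sumFin-+ (λ u → count (λ v → G u v ∧ H u v))
                                 (λ u → count (λ v → G u v ∧ not (H u v))))

arcs-∩-comm : ∀ {n} (G H : Digraph n) → arcs (G ∩ H) ≡ arcs (H ∩ G)
arcs-∩-comm G H = sumFin-cong _ _ (λ u → count-cong _ _ (λ v → ∧-comm (G u v) (H u v)))

-- Cancelling the common arcs: the smaller digraph has fewer private arcs.
arcDiff-antitone : ∀ {n} (G H : Digraph n) → arcs H ≤ arcs G → arcDiff H G ≤ arcDiff G H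
arcDiff-antitone G H H≤G = +-cancelˡ-≤ (arcs (G ∩ H)) _ _ (begin
  arcs (G ∩ H) + arcDiff H G   ≡⟨ cong (_+ arcDiff H G) (arcs-∩-comm G H) ⟩
  arcs (H ∩ G) + arcDiff H G   ≡⟨ arcs-split H G ⟨
  arcs H                       ≤⟨ H≤G ⟩
  arcs G                       ≡⟨ arcs-split G H ⟩
  arcs (G ∩ H) + arcDiff G H   ∎)
  where open ≤-Reasoning

≡ᵇ0⇒≡0 : ∀ m → (m ≡ᵇ 0) ≡ true → m ≡ 0
≡ᵇ0⇒≡0 m eq = ≡ᵇ⇒≡ m 0 (Equivalence.from T-≡ eq)

-- In an out-tree every non-root vertex has an in-arc, so |A(T)| ≥ n - 1.
outTree-arcs : ∀ {n} (T : Digraph n) → OutTree T → n ≤ suc (arcs T)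
outTree-arcs {n} T (_ , root , _ , rootUnique) = begin
  n                          ≡⟨ count-all ⟨
  count {n} (λ _ → true)     ≤⟨ count-≤-suc-sum _ (indeg T) root hasInArc ⟩
  suc (sumFin (indeg T))     ≡⟨ cong suc (count-swap T) ⟨
  suc (arcs T)               ∎
  where
  open ≤-Reasoning
  hasInArc : ∀ v → true ≡ true → v ≢ root → 1 ≤ indeg T v
  hasInArc v _ v≢root = n≢0⇒n>0 (v≢root ∘ rootUnique v)

newElement : ∀ {n} (f g : Fin n → Bool) → count f ≡ 0 → count g ≢ 0 →
  1 ≤ count (λ v → g v ∧ not (f v))
newElement f g noF someG with count-pos g (n≢0⇒n>0 someG)
... | v , gv = count-witness _ v (subst (λ b → (g v ∧ not b) ≡ true) (sym (count-zero f noF v))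
                                        (cong (_∧ true) gv))

-- Each leaf of T other than the sink of the in-tree T' has an out-arc of
-- T' that is not an arc of T.
outLeaves-bound : ∀ {n} (T T' : Digraph n) → InTree T' → outLeaves T ≤ suc (arcDiff T' T)
outLeaves-bound T T' (_ , sink , _ , sinkUnique) =
  count-≤-suc-sum _ _ sink λ u leaf u≢sink →
    newElement (T u) (T' u) (≡ᵇ0⇒≡0 _ leaf) (u≢sink ∘ sinkUnique u)

-- Each leaf of T other than the root of the out-tree T' has an in-arc of
-- T' that is not an arc of T.
inLeaves-bound : ∀ {n} (T T' : Digraph n) → OutTree T' → inLeaves T ≤ suc (arcDiff T' T)
inLeaves-bound T T' (_ , root , _ , rootUnique) =
  subst (λ m → inLeaves T ≤ suc m) (sym (count-swap (λ u v → T' u v ∧ not (T u v))))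
    (count-≤-suc-sum _ _ root λ v leaf v≢root →
      newElement (λ u → T u v) (λ u → T' u v) (≡ᵇ0⇒≡0 _ leaf) (v≢root ∘ rootUnique v))

-- Walks and simple lists

adj-sym : ∀ {n} (T : Digraph n) {u v} → Adj T u v → Adj T v u
adj-sym T {u} {v} uv = trans (∨-comm (T v u) (T u v)) uv

arc⇒adj : ∀ {n} (T : Digraph n) {u v} → T u v ≡ true → Adj T v u
arc⇒adj T {u} {v} uv rewrite uv = ∨-zeroʳ (T v u)

walk-prefix : ∀ {n} (T : Digraph n) L y R → Walk T (L ++ y ∷ R) → Walk T (L ++ [ y ])
walk-prefix T []           y R w       = tt
walk-prefix T (x ∷ [])     y R (a , w) = a , tt
walk-prefix T (x ∷ x' ∷ L) y R (a , w) = a , walk-prefix T (x' ∷ L) y R w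

walk-reverse : ∀ {n} (T : Digraph n) xs → Walk T xs → Walk T (reverse xs)
walk-reverse T []       w = tt
walk-reverse T (x ∷ xs) w = onto x xs [] w tt
  where
  -- reverse (x ∷ xs) is built by pushing xs onto the accumulator x ∷ acc
  onto : ∀ x xs acc → Walk T (x ∷ xs) → Walk T (x ∷ acc) →
         Walk T (reverseAcc (x ∷ acc) xs)
  onto x []       acc _       w' = w'
  onto x (y ∷ ys) acc (a , w) w' = onto y ys (x ∷ acc) w (adj-sym T a , w')

-- reverse is a permutation, so it preserves simplicity of lists.
unique-reverse : ∀ {A : Set} (xs : List A) → Unique xs → Unique (reverse xs)
unique-reverse {A} xs =
  PermutationProperties.Unique-resp-↭ (setoid A) (↭⇒↭ₛ (↭-sym (↭-reverse xs)))

unique-prefix : ∀ {A : Set} (L : List A) y R → Unique (L ++ y ∷ R) → Unique (y ∷ L)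
unique-prefix []      y R (_ ∷ _)    = [] ∷ []
unique-prefix (x ∷ L) y R (x∉ ∷ u) with unique-prefix L y R u | ++⁻ʳ L x∉
... | y∉L ∷ uL | x≢y ∷ _ = ((x≢y ∘ sym) ∷ y∉L) ∷ (++⁻ˡ L x∉ ∷ uL)

-- In-trees have out-degree at most one.  The argument uses only that T is
-- oriented, has no cycle, and that every vertex other than the sink has an
-- out-arc.
module InTreeDegree {n : ℕ} (T : Digraph n) (oriented : Oriented T) (acyclic : ¬ HasCycle T)
                    (sink : Fin n) (sinkUnique : ∀ v → outdeg T v ≡ 0 → v ≡ sink) where

  open DecMembership (_≟_ {n}) using (_∈?_; _∉?_)

  noLoop : ∀ {u v} → T u v ≡ true → v ≢ u
  noLoop {u} uv refl with trans (sym uv) (proj₁ oriented u)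
  ... | ()

  noAntiparallel : ∀ {u v} → T u v ≡ true → T v u ≢ true
  noAntiparallel {u} {v} uv vu with trans (sym vu) (proj₂ oriented u v uv)
  ... | ()

  successor : ∀ e → e ≢ sink → Σ (Fin n) λ y → T e y ≡ true
  successor e e≢sink = count-pos (T e) (n≢0⇒n>0 (e≢sink ∘ sinkUnique e))

  -- An arc from the head e of a simple walk e, p, … back into the walk can
  -- only end at e or p: anything else closes a cycle.
  noChord : ∀ e p rest y → Unique (e ∷ p ∷ rest) → Walk T (e ∷ p ∷ rest) →
            T e y ≡ true → y ∈ e ∷ p ∷ rest → y ≢ e → y ≢ p → ⊥
  noChord e p rest y u w ey (here y≡e)         y≢e y≢p = y≢e y≡e
  noChord e p rest y u w ey (there (here y≡p)) y≢e y≢p = y≢p y≡p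
  noChord e p rest y u w ey (there (there y∈rest)) y≢e y≢p with ∈-∃++ y∈rest
  ... | R₁ , R₂ , refl =
    acyclic (y , e ∷ p ∷ R₁ , s≤s (s≤s z≤n) , unique-prefix (e ∷ p ∷ R₁) y R₂ u ,
             arc⇒adj T ey , walk-prefix T (e ∷ p ∷ R₁) y R₂ w)

  -- The number of vertices off a list; it measures how far a simple walk
  -- can still grow.
  unvisited : List (Fin n) → ℕ
  unvisited R = count (λ v → does (v ∉? R))

  unvisited-shrinks : ∀ y R → y ∉ R → unvisited (y ∷ R) < unvisited R
  unvisited-shrinks y R y∉R =
    count-< _ _ stillOff y (dec-true (y ∉? R) y∉R) (dec-false (y ∉? (y ∷ R)) (λ y∉yR → y∉yR (here refl)))
    where
    off⇒∉ : ∀ {v} W → does (v ∉? W) ≡ true → v ∉ W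
    off⇒∉ {v} W off v∈W with trans (sym off) (cong not (dec-true (v ∈? W) v∈W))
    ... | ()
    stillOff : ∀ v → does (v ∉? (y ∷ R)) ≡ true → does (v ∉? R) ≡ true
    stillOff v off = dec-true (v ∉? R) (off⇒∉ (y ∷ R) off ∘ there)

  -- H extends the walk W (whose head is e) to a longer simple walk by fresh
  -- vertices, and the extension reaches the sink.
  ReachesSink : Fin n → List (Fin n) → Set
  ReachesSink e W = Σ (List (Fin n)) λ H →
    Unique (H ++ W) × Walk T (H ++ W) × All (_∉ W) H × (sink ∈ H ⊎ e ≡ sink)

  reachesSink-step : ∀ {e y} W → y ∉ W → ReachesSink y (y ∷ W) → ReachesSink e W
  reachesSink-step {e} {y} W y∉W (H , u , w , fresh , reach) =
    H ++ [ y ] ,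
    subst Unique (sym (++-assoc H [ y ] W)) u ,
    subst (Walk T) (sym (++-assoc H [ y ] W)) w ,
    ++⁺ (All.map (_∘ there) fresh) (y∉W ∷ []) ,
    inj₁ (extended reach)
    where
    extended : sink ∈ H ⊎ y ≡ sink → sink ∈ H ++ [ y ]
    extended (inj₁ sink∈H) = ∈-++⁺ˡ sink∈H
    extended (inj₂ y≡sink) = ∈-++⁺ʳ H (here (sym y≡sink))

  -- Following out-arcs from the head of a simple walk entered by an arc
  -- p → e never revisits the walk and ends at the sink.  The fuel bounds
  -- the number of unvisited vertices.
  reachSink-within : (k : ℕ) (e p : Fin n) (rest : List (Fin n)) →
    unvisited (e ∷ p ∷ rest) < k → Unique (e ∷ p ∷ rest) → Walk T (e ∷ p ∷ rest) →
    T p e ≡ true → ReachesSink e (e ∷ p ∷ rest)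
  reachSink-within (suc k) e p rest fuel u w pe with e ≟ sink
  ... | yes e≡sink = [] , u , w , [] , inj₂ e≡sink
  ... | no e≢sink with successor e e≢sink
  ... | y , ey with y ∈? (e ∷ p ∷ rest)
  ... | yes y∈W = ⊥-elim (noChord e p rest y u w ey y∈W (noLoop ey)
                            (λ { refl → noAntiparallel pe ey }))
  ... | no y∉W  = reachesSink-step (e ∷ p ∷ rest) y∉W
                    (reachSink-within k y e (p ∷ rest)
                      (<-≤-trans (unvisited-shrinks y _ y∉W) (≤-pred fuel))
                      (¬Any⇒All¬ _ y∉W ∷ u) (arc⇒adj T ey , w) ey)

  reachSink : ∀ e p rest → Unique (e ∷ p ∷ rest) → Walk T (e ∷ p ∷ rest) →
              T p e ≡ true → ReachesSink e (e ∷ p ∷ rest)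
  reachSink e p rest = reachSink-within (suc n) e p rest (s≤s (count-≤-length _))

  -- A simple walk u, b, … through the sink leaves no second out-neighbour
  -- a ≠ b for u: a is either on the walk (a chord) or starts a fresh walk
  -- to the sink, which is already used.
  sinkWalk-blocks : ∀ u b rest a → Unique (u ∷ b ∷ rest) → Walk T (u ∷ b ∷ rest) →
                    sink ∈ u ∷ b ∷ rest → T u a ≡ true → a ≢ b → ⊥
  sinkWalk-blocks u b rest a u' w sink∈W ua a≢b with a ∈? (u ∷ b ∷ rest)
  ... | yes a∈W = noChord u b rest a u' w ua a∈W (noLoop ua) a≢b
  ... | no  a∉W with reachSink a u (b ∷ rest) (¬Any⇒All¬ _ a∉W ∷ u') (arc⇒adj T ua , w) ua
  ...   | _ , _ , _ , fresh , inj₁ sink∈H = All.lookup fresh sink∈H (there sink∈W)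
  ...   | _ , _ , _ , _     , inj₂ a≡sink = a∉W (subst (_∈ _) (sym a≡sink) sink∈W)

  -- Two distinct out-neighbours a, b of u are impossible: the walk from u
  -- through b to the sink blocks a.
  twoSuccessors-absurd : ∀ {u a b} → T u a ≡ true → T u b ≡ true → a ≢ b → ⊥
  twoSuccessors-absurd {u} {a} {b} ua ub a≢b
    with reachSink b u [] ((noLoop ub ∷ []) ∷ [] ∷ []) (arc⇒adj T ub , tt) ub
  ... | H , u' , w , _ , reach =
    sinkWalk-blocks u b (reverse H) a
      (subst Unique reversed (unique-reverse P u'))
      (subst (Walk T) reversed (walk-reverse T P w))
      (subst (sink ∈_) reversed (reverse⁺ (sinkOnPath reach)))
      ua a≢b
    where
    -- the walk from the sink back through b to u
    P : List (Fin _)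
    P = H ++ b ∷ u ∷ []
    reversed : reverse P ≡ u ∷ b ∷ reverse H
    reversed = reverse-++ H (b ∷ u ∷ [])
    sinkOnPath : sink ∈ H ⊎ b ≡ sink → sink ∈ P
    sinkOnPath (inj₁ sink∈H) = ∈-++⁺ˡ sink∈H
    sinkOnPath (inj₂ b≡sink) = ∈-++⁺ʳ H (here (sym b≡sink))

  outdeg≤1 : ∀ u → outdeg T u ≤ 1
  outdeg≤1 u with outdeg T u ≤? 1
  ... | yes ≤1 = ≤1
  ... | no  ≰1 with count-two (T u) (≰⇒> ≰1)
  ...   | a , b , a≢b , ua , ub = ⊥-elim (twoSuccessors-absurd ua ub a≢b)

inTree-arcs : ∀ {n} (T : Digraph n) → InTree T → suc (arcs T) ≤ n
inTree-arcs T ((oriented , _ , acyclic) , sink , sinkOut , sinkUnique) =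
  sum-<-length (outdeg T) sink (InTreeDegree.outdeg≤1 T oriented acyclic sink sinkUnique) sinkOut

lemma1 : ∀ {n} (D : Digraph n) →
    Σ (Digraph n) (OutBranching D) →
    Σ (Digraph n) (InBranching D) →
    (k : ℕ) →
    ((T : Digraph n) → OutBranching D T → suc k ≤ outLeaves T →
    (T' : Digraph n) → InBranching D T' → k ≤ arcDiff T T')
    ×
    ((T : Digraph n) → InBranching D T → suc k ≤ inLeaves T →
    (T' : Digraph n) → OutBranching D T' → k ≤ arcDiff T' T)
lemma1 D _ _ k = outBranchingCase , inBranchingCase
  where
  outBranchingCase : ∀ T → OutBranching D T → suc k ≤ outLeaves T →
                     ∀ T' → InBranching D T' → k ≤ arcDiff T T'
  outBranchingCase T (outTree , _) leaves T' (inTree , _) = begin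
    k                ≤⟨ ≤-pred (≤-trans leaves (outLeaves-bound T T' inTree)) ⟩
    arcDiff T' T     ≤⟨ arcDiff-antitone T T' fewerArcs ⟩
    arcDiff T T'     ∎
    where
    open ≤-Reasoning
    fewerArcs : arcs T' ≤ arcs T
    fewerArcs = ≤-pred (≤-trans (inTree-arcs T' inTree) (outTree-arcs T outTree))

  inBranchingCase : ∀ T → InBranching D T → suc k ≤ inLeaves T →
                    ∀ T' → OutBranching D T' → k ≤ arcDiff T' T
  inBranchingCase T _ leaves T' (outTree , _) =
    ≤-pred (≤-trans leaves (inLeaves-bound T T' outTree))
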